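{- For every $n\ge4$, $K_n = 4K_{n-2} - 6 + 2\cdot(-1)^n$, where $K_m$ is the number of non-colourable strings in $\{0,1\}^m$.
   Context: $\#w$ is the length, $\varepsilon$ the empty string; for $\#w\ge1$, $l(w)$ is $w$ without its last letter and $r(w)$ is $w$ without its first letter. $T^n$ is the alternating string of length $n$ starting with $0$ ($T^0=\varepsilon$, $T^n=T^{n-1}0$ for odd $n$, $T^n=T^{n-1}1$ for even $n\ge2$) and $CT^n$ its letterwise complement. $\xi$: $\xi(\varepsilon)=0$; $\xi(w)=1$ if $w=T^k$, $k\ge2$ even; $\xi(w)=-1$ if $w=CT^k$, $k\ge2$ even; otherwise $\xi(w)=\operatorname{sgn}(\xi(l(w))+\xi(r(w)))$. $\phi$: $\phi(\varepsilon)=0$; $\phi(w)=-1$ if $w=0^k$, $k$ odd; $\phi(w)=1$ if $w=1^k$, $k$ odd; otherwise $\phi(w)=\operatorname{sgn}(\phi(r(w))-\phi(l(w)))$. $\psi(w)=\xi(w)^{\#w}\phi(w)$ (with $0^0=1$); $w$ is colourable iff $\psi(w)\ne0$. $K_n=\#\{w\in\{0,1\}^n:\psi(w)=0\}$. -}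

module Defs where

open import Data.Bool using (Bool; true; false; if_then_else_)
import Data.Bool as B
open import Data.Nat using (ℕ; zero; suc)
import Data.Nat as N
open import Data.Integer using (ℤ; +_; -[1+_]; _+_; _-_; _*_; -_; _^_)
open import Data.Vec using (Vec; []; _∷_; _∷ʳ_; init; tail; replicate)
open import Data.Vec.Properties using (≡-dec)
open import Data.List using (List; []; _∷_; _++_; map; filter; length)
open import Relation.Nullary using (Dec; yes; no; does)
open import Relation.Binary.PropositionalEquality using (_≡_)

-- Binary strings of length n: Vec Bool n, with false = 0 and true = 1.
Word : ℕ → Set
Word n = Vec Bool n

sgn : ℤ → ℤ
sgn (+ zero)  = + 0
sgn (+ suc _) = + 1
sgn -[1+ _ ]  = -[1+ 0 ]

odd : ℕ → Bool
odd zero    = false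
odd (suc n) = B.not (odd n)

T : (n : ℕ) → Word n
T zero    = []
T (suc n) = T n ∷ʳ (if odd (suc n) then false else true)

CT : (n : ℕ) → Word n
CT n = Data.Vec.map B.not (T n)

_==_ : ∀ {n} → Word n → Word n → Bool
w == v = does (≡-dec B._≟_ w v)

evenGe2 : ℕ → Bool
evenGe2 zero          = false
evenGe2 (suc zero)    = false
evenGe2 (suc (suc n)) = B.not (odd n)

oddN : ℕ → Bool
oddN = odd

-- l(w) = init w (drop last letter), r(w) = tail w (drop first letter).
ξ : (n : ℕ) → Word n → ℤ
ξ zero    []  = + 0
ξ (suc n) w =
  if evenGe2 (suc n) B.∧ (w == T (suc n)) then + 1
  else if evenGe2 (suc n) B.∧ (w == CT (suc n)) then -[1+ 0 ]
  else sgn (ξ n (init w) + ξ n (tail w))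

φ : (n : ℕ) → Word n → ℤ
φ zero    []  = + 0
φ (suc n) w =
  if oddN (suc n) B.∧ (w == replicate (suc n) false) then -[1+ 0 ]
  else if oddN (suc n) B.∧ (w == replicate (suc n) true) then + 1
  else sgn (φ n (tail w) - φ n (init w))

-- ψ(w) = ξ(w)^{#w} φ(w)   (Agda's _^_ has x ^ 0 = 1, i.e. 0^0 = 1)
ψ : (n : ℕ) → Word n → ℤ
ψ n w = (ξ n w ^ n) * φ n w

allWords : (n : ℕ) → List (Word n)
allWords zero    = [] ∷ []
allWords (suc n) = map (false ∷_) (allWords n) ++ map (true ∷_) (allWords n)

K : ℕ → ℕ
K n = length (filter (λ w → Data.Integer._≟_ (ψ n w) (+ 0)) (allWords n))

module Submission where

-- Peel the two end letters off a word a ∷ w ∷ʳ b with |w| ≥ 2. Then ξ(awb) = ξ(w) and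
-- φ(awb) = -φ(w), except when w is constant or alternating, where the value is ±1 outright.
-- This is proved by induction on |w|: unfold the defining recursion once, peel both halves by
-- the induction hypothesis, and compare with peeling first; when the middle is constant or
-- alternating, ξ and φ of the halves are known explicitly and the comparison becomes a finite
-- check. Consequently ψ(awb) = 0 iff ψ(w) = 0 and not (a ≠ b and w is special), the special
-- words -- the two constant ones and, for odd |w|, the two alternating ones -- all having
-- ψ = 0. Summing over the four choices of (a, b) gives K(n+2) = 2 K(n) + 2 (K(n) - s(n)) with
-- s(n) = 3 - (-1)ⁿ special words.

open import Defs
open import Data.Nat using (ℕ; _≤_; _∸_)
open import Data.Integer using (ℤ; +_; -[1+_]; _+_; _-_; _*_; _^_)
open import Relation.Binary.PropositionalEquality using (_≡_)

import Data.Bool as B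
open import Data.Bool using (Bool; true; false; not; _∧_; _∨_; _xor_; if_then_else_)
open import Data.Bool.Properties
  using (T-∧; ∧-comm; ∧-assoc; ∧-identityʳ; ∧-zeroʳ; ∧-distribˡ-∨; ∨-assoc; ∨-identityʳ; ∨-idem;
         not-involutive; xor-identityʳ; not-distribˡ-xor; not-distribʳ-xor)
open import Data.Nat using (zero; suc; s≤s)
import Data.Nat as ℕ
import Data.Nat.Properties as ℕ
open import Data.Nat.Tactic.RingSolver using () renaming (solve-∀ to ℕ-solve-∀)
open import Algebra.Properties.CommutativeSemigroup ℕ.+-commutativeSemigroup
  using () renaming (interchange to +-interchange)
open import Data.Integer using (-_)
import Data.Integer as ℤ
open import Data.Integer.Properties
  using (pos-+; pos-*; *-zeroʳ; i*j≡0⇒i≡0∨j≡0; +-identityˡ; +-identityʳ; +-inverseʳ; neg-distrib-+)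
open import Data.Integer.Tactic.RingSolver using () renaming (solve-∀ to ℤ-solve-∀)
open import Data.Product using (_,_; proj₁; proj₂)
open import Data.Sum using ([_,_])
open import Data.Vec using (Vec; []; _∷_; _∷ʳ_; init; tail; replicate; initLast)
import Data.Vec as V
open import Data.Vec.Properties using (init-∷ʳ; ≡-dec)
open import Data.List using (length; filter)
import Data.List as L
open import Data.List.Properties using (length-++; filter-++)
open import Function using (_∘_; Equivalence)
open import Relation.Binary.PropositionalEquality using (refl; sym; trans; cong; cong₂; subst; module ≡-Reasoning)
open import Relation.Nullary using (Dec; does; yes; no; contradiction)
open import Relation.Nullary.Decidable using (dec-true; dec-false; ⌊_⌋; toWitness)
import Relation.Unary as U

-- Constant and alternating words

_≡ᵇ_ : Bool → Bool → Bool
x ≡ᵇ y = does (x B.≟ y)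

sign : Bool → ℤ
sign false = + 1
sign true  = -[1+ 0 ]

alternating : Bool → (n : ℕ) → Word n
alternating x zero    = []
alternating x (suc n) = x ∷ alternating (not x) n

replicate-∷ʳ : ∀ n (x : Bool) → replicate (suc n) x ≡ replicate n x ∷ʳ x
replicate-∷ʳ zero    x = refl
replicate-∷ʳ (suc n) x = cong (x ∷_) (replicate-∷ʳ n x)

not-xor-swap : ∀ x y → not x xor y ≡ x xor not y
not-xor-swap x y = trans (sym (not-distribˡ-xor x y)) (not-distribʳ-xor x y)

alternating-∷ʳ : ∀ x n → alternating x (suc n) ≡ alternating x n ∷ʳ (x xor odd n)
alternating-∷ʳ x zero    = cong (_∷ []) (sym (xor-identityʳ x))
alternating-∷ʳ x (suc n) = cong (x ∷_) (begin
  alternating (not x) (suc n)                ≡⟨ alternating-∷ʳ (not x) n ⟩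
  alternating (not x) n ∷ʳ (not x xor odd n) ≡⟨ cong (alternating (not x) n ∷ʳ_) (not-xor-swap x (odd n)) ⟩
  alternating (not x) n ∷ʳ (x xor odd (suc n)) ∎)
  where open ≡-Reasoning

==-∷ʳ : ∀ {n} (u v : Word n) d e → (u ∷ʳ d) == (v ∷ʳ e) ≡ (u == v) ∧ (d ≡ᵇ e)
==-∷ʳ []      []      d e = ∧-identityʳ (d ≡ᵇ e)
==-∷ʳ (x ∷ u) (y ∷ v) d e =
  trans (cong ((x ≡ᵇ y) ∧_) (==-∷ʳ u v d e)) (sym (∧-assoc (x ≡ᵇ y) (u == v) (d ≡ᵇ e)))

==-refl : ∀ {n} (w : Word n) → w == w ≡ true
==-refl w = dec-true (≡-dec B._≟_ w w) refl

==-sound : ∀ {n} {w v : Word n} → w == v ≡ true → w ≡ v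
==-sound {w = w} {v} h with ≡-dec B._≟_ w v
... | yes w≡v = w≡v
... | no  _   = contradiction h λ ()

record Profile : Set where
  constructor profile
  field
    const₀ const₁ alt₀ alt₁ : Bool

open Profile

profile-cong : ∀ {k₀ k₁ a₀ a₁ k₀′ k₁′ a₀′ a₁′} →
  k₀ ≡ k₀′ → k₁ ≡ k₁′ → a₀ ≡ a₀′ → a₁ ≡ a₁′ → profile k₀ k₁ a₀ a₁ ≡ profile k₀′ k₁′ a₀′ a₁′
profile-cong refl refl refl refl = refl

profileOf : ∀ {n} → Word n → Profile
profileOf {n} w = profile (w == replicate n false) (w == replicate n true)
                          (w == alternating false n) (w == alternating true n)

isConstant isAlternating : Profile → Bool
isConstant    p = const₀ p ∨ const₁ p
isAlternating p = alt₀ p ∨ alt₁ p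

-- Flags are tested before letters so that, on the all-false profile, these reduce without
-- inspecting the letters.
consP : Bool → Profile → Profile
consP c p = profile (const₀ p ∧ (c ≡ᵇ false)) (const₁ p ∧ (c ≡ᵇ true))
                    (alt₁ p ∧ (c ≡ᵇ false)) (alt₀ p ∧ (c ≡ᵇ true))

-- The Boolean argument is the parity of the length of the word being extended.
snocP : Profile → Bool → Bool → Profile
snocP p o d = profile (const₀ p ∧ (d ≡ᵇ false)) (const₁ p ∧ (d ≡ᵇ true))
                      (alt₀ p ∧ (d ≡ᵇ o)) (alt₁ p ∧ (d ≡ᵇ not o))

profileOf-∷ : ∀ {n} c (u : Word n) → profileOf (c ∷ u) ≡ consP c (profileOf u)
profileOf-∷ c u = profile-cong (∧-comm (c ≡ᵇ false) _) (∧-comm (c ≡ᵇ true) _)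
                               (∧-comm (c ≡ᵇ false) _) (∧-comm (c ≡ᵇ true) _)

profileOf-∷ʳ : ∀ {n} (u : Word n) d → profileOf (u ∷ʳ d) ≡ snocP (profileOf u) (odd n) d
profileOf-∷ʳ {n} u d = profile-cong (via (replicate-∷ʳ n false)) (via (replicate-∷ʳ n true))
                                    (via (alternating-∷ʳ false n)) (via (alternating-∷ʳ true n))
  where
  via : ∀ {w v e} → w ≡ v ∷ʳ e → (u ∷ʳ d) == w ≡ (u == v) ∧ (d ≡ᵇ e)
  via {v = v} {e} eq = trans (cong ((u ∷ʳ d) ==_) eq) (==-∷ʳ u v d e)

profileOf-∷-to : ∀ {n} c (u : Word n) {p} → profileOf u ≡ p → profileOf (c ∷ u) ≡ consP c p
profileOf-∷-to c u refl = profileOf-∷ c u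

profileOf-∷ʳ-to : ∀ {n} (u : Word n) d {p} → profileOf u ≡ p → profileOf (u ∷ʳ d) ≡ snocP p (odd n) d
profileOf-∷ʳ-to u d refl = profileOf-∷ʳ u d

constantProfile alternatingProfile : Bool → Profile
constantProfile    x = profile (x ≡ᵇ false) (x ≡ᵇ true) false false
alternatingProfile x = profile false false (x ≡ᵇ false) (x ≡ᵇ true)

mixedProfile : Profile
mixedProfile = profile false false false false

profileOf-replicate : ∀ k x → profileOf (replicate (suc (suc k)) x) ≡ constantProfile x
profileOf-replicate k false = profile-cong (==-refl (replicate k false)) refl refl refl
profileOf-replicate k true  = profile-cong refl (==-refl (replicate k true)) refl refl

profileOf-alternating : ∀ k x → profileOf (alternating x (suc (suc k))) ≡ alternatingProfile x
profileOf-alternating k false = profile-cong refl refl (==-refl (alternating false k)) refl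
profileOf-alternating k true  = profile-cong refl refl refl (==-refl (alternating true k))

data Shape {n} (u : Word n) : Set where
  constant    : ∀ x → u ≡ replicate n x   → Shape u
  alternates  : ∀ x → u ≡ alternating x n → Shape u
  mixed       : profileOf u ≡ mixedProfile → Shape u

shape : ∀ {n} (u : Word n) → Shape u
shape {n} u with u == replicate n false in k₀ | u == replicate n true in k₁
               | u == alternating false n in a₀ | u == alternating true n in a₁
... | true  | _     | _     | _     = constant false (==-sound k₀)
... | false | true  | _     | _     = constant true (==-sound k₁)
... | false | false | true  | _     = alternates false (==-sound a₀)
... | false | false | false | true  = alternates true (==-sound a₁)
... | false | false | false | false = mixed (profile-cong k₀ k₁ a₀ a₁)

T≡alternating : ∀ n → T n ≡ alternating false n
T≡alternating zero    = refl
T≡alternating (suc n) =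
  trans (cong₂ _∷ʳ_ (T≡alternating n) (last-letter (odd n))) (sym (alternating-∷ʳ false n))
  where
  last-letter : ∀ o → (if not o then false else true) ≡ o
  last-letter false = refl
  last-letter true  = refl

CT≡alternating : ∀ n → CT n ≡ alternating true n
CT≡alternating n = trans (cong (V.map not) (T≡alternating n)) (map-not false n)
  where
  map-not : ∀ x n → V.map not (alternating x n) ≡ alternating (not x) n
  map-not x zero    = refl
  map-not x (suc n) = cong (not x ∷_) (map-not (not x) n)

ξ-step : Profile → Bool → ℤ → ℤ → ℤ
ξ-step p e y z = if alt₀ p ∧ e then + 1 else if alt₁ p ∧ e then -[1+ 0 ] else sgn (y + z)

φ-step : Profile → Bool → ℤ → ℤ → ℤ
φ-step p o y z = if const₀ p ∧ o then -[1+ 0 ] else if const₁ p ∧ o then + 1 else sgn (y - z)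

ξ-unfold : ∀ n (w : Word (suc n)) →
  ξ (suc n) w ≡ ξ-step (profileOf w) (evenGe2 (suc n)) (ξ n (init w)) (ξ n (tail w))
ξ-unfold n w =
  cong₂ (λ t₀ t₁ → if t₀ then + 1 else if t₁ then -[1+ 0 ] else sgn (ξ n (init w) + ξ n (tail w)))
        (flag (T≡alternating (suc n))) (flag (CT≡alternating (suc n)))
  where
  e : Bool
  e = evenGe2 (suc n)
  flag : ∀ {v v′} → v ≡ v′ → e ∧ (w == v) ≡ (w == v′) ∧ e
  flag {v′ = v′} refl = ∧-comm e (w == v′)

φ-unfold : ∀ n (w : Word (suc n)) →
  φ (suc n) w ≡ φ-step (profileOf w) (odd (suc n)) (φ n (tail w)) (φ n (init w))
φ-unfold n w
  rewrite ∧-comm (odd (suc n)) (w == replicate (suc n) false)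
        | ∧-comm (odd (suc n)) (w == replicate (suc n) true) = refl

ξ-unfold-to : ∀ {n} (w : Word (suc n)) {p y z} →
  profileOf w ≡ p → ξ n (init w) ≡ y → ξ n (tail w) ≡ z → ξ (suc n) w ≡ ξ-step p (evenGe2 (suc n)) y z
ξ-unfold-to {n} w refl refl refl = ξ-unfold n w

φ-unfold-to : ∀ {n} (w : Word (suc n)) {p y z} →
  profileOf w ≡ p → φ n (tail w) ≡ y → φ n (init w) ≡ z → φ (suc n) w ≡ φ-step p (odd (suc n)) y z
φ-unfold-to {n} w refl refl refl = φ-unfold n w

init-replicate : ∀ n (x : Bool) → init (replicate (suc n) x) ≡ replicate n x
init-replicate n x = trans (cong init (replicate-∷ʳ n x)) (init-∷ʳ x (replicate n x))

init-alternating : ∀ x n → init (alternating x (suc n)) ≡ alternating x n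
init-alternating x n = trans (cong init (alternating-∷ʳ x n)) (init-∷ʳ (x xor odd n) (alternating x n))

evenGe2-suc : ∀ m → evenGe2 (suc m) ≡ odd m
evenGe2-suc zero    = refl
evenGe2-suc (suc m) = refl

sgn-sign : ∀ x → sgn (sign x) ≡ sign x
sgn-sign false = refl
sgn-sign true  = refl

snocP-constant-flip : ∀ x o → snocP (constantProfile x) o (not x) ≡ mixedProfile
snocP-constant-flip false o = refl
snocP-constant-flip true  o = refl

consP-flip-constant : ∀ x → consP (not x) (constantProfile x) ≡ mixedProfile
consP-flip-constant false = refl
consP-flip-constant true  = refl

consP-repeat-alternating : ∀ x → consP x (alternatingProfile x) ≡ mixedProfile
consP-repeat-alternating false = refl
consP-repeat-alternating true  = refl

snocP-repeat-alternating : ∀ x o → snocP (alternatingProfile x) o (not (x xor o)) ≡ mixedProfile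
snocP-repeat-alternating false false = refl
snocP-repeat-alternating false true  = refl
snocP-repeat-alternating true  false = refl
snocP-repeat-alternating true  true  = refl

ξ-replicate : ∀ n x → ξ n (replicate n x) ≡ + 0
ξ-replicate zero          x = refl
ξ-replicate (suc zero)    x = refl
ξ-replicate (suc (suc n)) x = ξ-unfold-to (replicate (suc (suc n)) x) (profileOf-replicate n x)
  (trans (cong (ξ (suc n)) (init-replicate (suc n) x)) (ξ-replicate (suc n) x)) (ξ-replicate (suc n) x)

ξ-alternating : ∀ n x → ξ n (alternating x n) ≡ (if evenGe2 n then sign x else + 0)
ξ-alternating zero          x = refl
ξ-alternating (suc zero)    x = refl
ξ-alternating (suc (suc n)) x = trans (ξ-unfold-to (alternating x (suc (suc n))) (profileOf-alternating n x)
    (trans (cong (ξ (suc n)) (init-alternating x (suc n))) (ξ-alternating (suc n) x))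
    (ξ-alternating (suc n) (not x)))
  (trans (cong (λ e → ξ-step (alternatingProfile x) (not (odd n)) (value x e) (value (not x) e)) (evenGe2-suc n))
         (combine x (odd n)))
  where
  value : Bool → Bool → ℤ
  value y e = if e then sign y else + 0
  combine : ∀ x o → ξ-step (alternatingProfile x) (not o) (value x o) (value (not x) o) ≡ value x (not o)
  combine false false = refl
  combine false true  = refl
  combine true  false = refl
  combine true  true  = refl

ξ-replicate-∷ʳ-flip : ∀ j x → ξ (suc (suc j)) (replicate (suc j) x ∷ʳ not x) ≡ sign x
ξ-replicate-∷ʳ-flip zero    false = refl
ξ-replicate-∷ʳ-flip zero    true  = refl
ξ-replicate-∷ʳ-flip (suc k) x = trans (ξ-unfold-to (replicate (suc (suc k)) x ∷ʳ not x)
    (trans (profileOf-∷ʳ-to (replicate (suc (suc k)) x) (not x) (profileOf-replicate k x)) (snocP-constant-flip x (odd (suc (suc k)))))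
    (trans (cong (ξ (suc (suc k))) (init-∷ʳ (not x) (replicate (suc (suc k)) x))) (ξ-replicate (suc (suc k)) x))
    (ξ-replicate-∷ʳ-flip k x))
  (trans (cong sgn (+-identityˡ (sign x))) (sgn-sign x))

ξ-flip-∷-replicate : ∀ j x → ξ (suc (suc j)) (not x ∷ replicate (suc j) x) ≡ sign (not x)
ξ-flip-∷-replicate zero    false = refl
ξ-flip-∷-replicate zero    true  = refl
ξ-flip-∷-replicate (suc k) x = trans (ξ-unfold-to (not x ∷ replicate (suc (suc k)) x)
    (trans (profileOf-∷-to (not x) (replicate (suc (suc k)) x) (profileOf-replicate k x)) (consP-flip-constant x))
    (trans (cong (λ u → ξ (suc (suc k)) (not x ∷ u)) (init-replicate (suc k) x)) (ξ-flip-∷-replicate k x))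
    (ξ-replicate (suc (suc k)) x))
  (trans (cong sgn (+-identityʳ (sign (not x)))) (sgn-sign (not x)))

ξ-repeat-∷-alternating : ∀ k x → ξ (suc (suc (suc k))) (x ∷ alternating x (suc (suc k))) ≡ sign x
ξ-repeat-∷-alternating zero    false = refl
ξ-repeat-∷-alternating zero    true  = refl
ξ-repeat-∷-alternating (suc m) x = trans (ξ-unfold-to (x ∷ alternating x (suc (suc (suc m))))
    (trans (profileOf-∷-to x (alternating x (suc (suc (suc m)))) (profileOf-alternating (suc m) x))
           (consP-repeat-alternating x))
    (trans (cong (λ u → ξ (suc (suc (suc m))) (x ∷ u)) (init-alternating x (suc (suc m))))
           (ξ-repeat-∷-alternating m x))
    (ξ-alternating (suc (suc (suc m))) x))
  (sign-arithmetic x (evenGe2 (suc (suc (suc m)))))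
  where
  sign-arithmetic : ∀ x q → sgn (sign x + (if q then sign x else + 0)) ≡ sign x
  sign-arithmetic false false = refl
  sign-arithmetic false true  = refl
  sign-arithmetic true  false = refl
  sign-arithmetic true  true  = refl

-- An alternating word with its last letter doubled: x xor odd n would have continued it.
ξ-alternating-doubled : ∀ k x →
  ξ (suc (suc (suc k))) (alternating x (suc (suc k)) ∷ʳ not (x xor odd (suc (suc k))))
  ≡ sign (x xor odd (suc (suc k)))
ξ-alternating-doubled zero    false = refl
ξ-alternating-doubled zero    true  = refl
ξ-alternating-doubled (suc m) x = trans (ξ-unfold-to (alternating x (suc (suc (suc m))) ∷ʳ _)
    (trans (profileOf-∷ʳ-to (alternating x (suc (suc (suc m)))) _ (profileOf-alternating (suc m) x))
           (snocP-repeat-alternating x _))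
    (trans (cong (ξ (suc (suc (suc m)))) (init-∷ʳ _ (alternating x (suc (suc (suc m))))))
           (ξ-alternating (suc (suc (suc m))) x))
    (trans (cong (λ e → ξ (suc (suc (suc m))) (alternating (not x) (suc (suc m)) ∷ʳ not e))
                 (sym (not-xor-swap x (odd (suc (suc m))))))
           (ξ-alternating-doubled m (not x))))
  (sign-arithmetic x (odd m))
  where
  sign-arithmetic : ∀ x o → sgn ((if not (not o) then sign x else + 0) + sign (not x xor not (not o)))
                   ≡ sign (x xor not (not (not o)))
  sign-arithmetic false false = refl
  sign-arithmetic false true  = refl
  sign-arithmetic true  false = refl
  sign-arithmetic true  true  = refl

φ-replicate : ∀ n x → φ n (replicate n x) ≡ (if odd n then sign (not x) else + 0)
φ-replicate zero          x     = refl
φ-replicate (suc zero)    false = refl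
φ-replicate (suc zero)    true  = refl
φ-replicate (suc (suc k)) x = trans (φ-unfold-to (replicate (suc (suc k)) x)
    (profileOf-replicate k x) refl (cong (φ (suc k)) (init-replicate (suc k) x)))
  (constant-step x (odd (suc (suc k))) (φ (suc k) (replicate (suc k) x)))
  where
  constant-step : ∀ x o y → φ-step (constantProfile x) o y y ≡ (if o then sign (not x) else + 0)
  constant-step false false y = cong sgn (+-inverseʳ y)
  constant-step true  false y = cong sgn (+-inverseʳ y)
  constant-step false true  y = refl
  constant-step true  true  y = refl

φ-replicate-∷ʳ-flip : ∀ j x → φ (suc (suc j)) (replicate (suc j) x ∷ʳ not x) ≡ sign x
φ-replicate-∷ʳ-flip zero    false = refl
φ-replicate-∷ʳ-flip zero    true  = refl
φ-replicate-∷ʳ-flip (suc k) x = trans (φ-unfold-to (replicate (suc (suc k)) x ∷ʳ not x)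
    (trans (profileOf-∷ʳ-to (replicate (suc (suc k)) x) (not x) (profileOf-replicate k x)) (snocP-constant-flip x (odd (suc (suc k)))))
    (φ-replicate-∷ʳ-flip k x)
    (trans (cong (φ (suc (suc k))) (init-∷ʳ (not x) (replicate (suc (suc k)) x))) (φ-replicate (suc (suc k)) x)))
  (sign-arithmetic x (odd (suc (suc k))))
  where
  sign-arithmetic : ∀ x q → sgn (sign x - (if q then sign (not x) else + 0)) ≡ sign x
  sign-arithmetic false false = refl
  sign-arithmetic false true  = refl
  sign-arithmetic true  false = refl
  sign-arithmetic true  true  = refl

φ-flip-∷-replicate : ∀ j x →
  φ (suc (suc j)) (not x ∷ replicate (suc j) x) ≡ (if odd (suc j) then sign (not x) else sign x)
φ-flip-∷-replicate zero    false = refl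
φ-flip-∷-replicate zero    true  = refl
φ-flip-∷-replicate (suc k) x = trans (φ-unfold-to (not x ∷ replicate (suc (suc k)) x)
    (trans (profileOf-∷-to (not x) (replicate (suc (suc k)) x) (profileOf-replicate k x)) (consP-flip-constant x))
    (φ-replicate (suc (suc k)) x)
    (trans (cong (λ u → φ (suc (suc k)) (not x ∷ u)) (init-replicate (suc k) x)) (φ-flip-∷-replicate k x)))
  (sign-arithmetic x (odd (suc k)))
  where
  sign-arithmetic : ∀ x o → sgn ((if not o then sign (not x) else + 0) - (if o then sign (not x) else sign x))
                   ≡ (if not o then sign (not x) else sign x)
  sign-arithmetic false false = refl
  sign-arithmetic false true  = refl
  sign-arithmetic true  false = refl
  sign-arithmetic true  true  = refl

-- Peeling both end letters

allAssignments : ∀ n → (Vec Bool n → Bool) → Bool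
allAssignments zero    p = p []
allAssignments (suc n) p = allAssignments n (λ v → p (false ∷ v)) ∧ allAssignments n (λ v → p (true ∷ v))

allAssignments-sound : ∀ n p → B.T (allAssignments n p) → ∀ v → B.T (p v)
allAssignments-sound zero    p t []          = t
allAssignments-sound (suc n) p t (false ∷ v) =
  allAssignments-sound n _ (proj₁ (Equivalence.to T-∧ t)) v
allAssignments-sound (suc n) p t (true ∷ v)  =
  allAssignments-sound n _ (proj₂ (Equivalence.to T-∧ t)) v

data Framed {A : Set} : ∀ {n} → Vec A (suc (suc n)) → Set where
  framed : ∀ {n} a (w : Vec A n) b → Framed (a ∷ (w ∷ʳ b))

frame : ∀ {A : Set} {n} (v : Vec A (suc (suc n))) → Framed v
frame (a ∷ t) with initLast t
... | w , b , refl = framed a w b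

-- The non-colourable words w for which a ∷ w ∷ʳ b is colourable as soon as a ≠ b: constant
-- words, and alternating words of odd length.
special : Profile → Bool → Bool
special p o = isConstant p ∨ (isAlternating p ∧ o)

ξ-flips : Bool → Profile → Bool → Bool → Bool
ξ-flips a p o b = (special p o ∨ isAlternating (consP a p)) ∧ (a xor b)

ξ-layer : Bool → Profile → Bool → Bool → ℤ → ℤ
ξ-layer a p o b X = if ξ-flips a p o b then sign a else X

ξ-Peels : ℕ → Set
ξ-Peels n = ∀ a b (w : Word n) → ξ (suc (suc n)) (a ∷ (w ∷ʳ b)) ≡ ξ-layer a (profileOf w) (odd n) b (ξ n w)

ξ-peels? : ∀ n a b (w : Word n) → Dec (ξ (suc (suc n)) (a ∷ (w ∷ʳ b)) ≡ ξ-layer a (profileOf w) (odd n) b (ξ n w))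
ξ-peels? n a b w = ξ (suc (suc n)) (a ∷ (w ∷ʳ b)) ℤ.≟ ξ-layer a (profileOf w) (odd n) b (ξ n w)

ξ-peels-at : ∀ n → Vec Bool (suc (suc n)) → Bool
ξ-peels-at n (a ∷ b ∷ w) = ⌊ ξ-peels? n a b w ⌋

ξ-peel-by-computation : ∀ n → B.T (allAssignments (suc (suc n)) (ξ-peels-at n)) → ξ-Peels n
ξ-peel-by-computation n t a b w =
  toWitness {a? = ξ-peels? n a b w} (allAssignments-sound (suc (suc n)) (ξ-peels-at n) t (a ∷ b ∷ w))

-- The two ways of evaluating ξ on a ∷ c ∷ u ∷ d ∷ b from ξ (c ∷ u) = X and ξ (u ∷ʳ d) = Y, where
-- o is the parity of the length of u: unfold the recursion once and peel both halves, or peel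
-- the outer pair off c ∷ u ∷ d and unfold that.
unfoldPeelξ peelUnfoldξ : Bool → Bool → Bool → Bool → Profile → Bool → ℤ → ℤ → ℤ
unfoldPeelξ a b c d p o X Y =
  ξ-step (consP a (consP c (snocP (snocP p o d) (not o) b))) (not (not (not o)))
         (ξ-layer a (consP c p) (not o) d X) (ξ-layer c (snocP p o d) (not o) b Y)
peelUnfoldξ a b c d p o X Y =
  ξ-layer a (consP c (snocP p o d)) (not (not o)) b (ξ-step (consP c (snocP p o d)) (not o) X Y)

ξ-unfoldPeel : ∀ {m} → ξ-Peels (suc m) → ∀ a b c d (u : Word m) →
  ξ (suc (suc (suc (suc m)))) (a ∷ ((c ∷ (u ∷ʳ d)) ∷ʳ b))
  ≡ unfoldPeelξ a b c d (profileOf u) (odd m) (ξ (suc m) (c ∷ u)) (ξ (suc m) (u ∷ʳ d))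
ξ-unfoldPeel {m} peel a b c d u = ξ-unfold-to (a ∷ ((c ∷ (u ∷ʳ d)) ∷ʳ b))
  (profileOf-∷-to a (c ∷ ((u ∷ʳ d) ∷ʳ b))
    (profileOf-∷-to c ((u ∷ʳ d) ∷ʳ b) (profileOf-∷ʳ-to (u ∷ʳ d) b (profileOf-∷ʳ u d))))
  (trans (cong (ξ (suc (suc (suc m)))) (init-∷ʳ b (a ∷ c ∷ (u ∷ʳ d))))
         (trans (peel a d (c ∷ u)) (cong (λ p → ξ-layer a p (not (odd m)) d (ξ (suc m) (c ∷ u))) (profileOf-∷ c u))))
  (trans (peel c b (u ∷ʳ d)) (cong (λ p → ξ-layer c p (not (odd m)) b (ξ (suc m) (u ∷ʳ d))) (profileOf-∷ʳ u d)))

ξ-peelUnfold : ∀ {m} a b c d (u : Word m) →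
  peelUnfoldξ a b c d (profileOf u) (odd m) (ξ (suc m) (c ∷ u)) (ξ (suc m) (u ∷ʳ d))
  ≡ ξ-layer a (profileOf (c ∷ (u ∷ʳ d))) (odd (suc (suc m))) b (ξ (suc (suc m)) (c ∷ (u ∷ʳ d)))
ξ-peelUnfold {m} a b c d u = sym (cong₂ (λ p X → ξ-layer a p (odd (suc (suc m))) b X) profile≡
  (ξ-unfold-to (c ∷ (u ∷ʳ d)) profile≡ (cong (ξ (suc m)) (init-∷ʳ d (c ∷ u))) refl))
  where
  profile≡ : profileOf (c ∷ (u ∷ʳ d)) ≡ consP c (snocP (profileOf u) (odd m) d)
  profile≡ = profileOf-∷-to c (u ∷ʳ d) (profileOf-∷ʳ u d)

ξ-∷-replicate : ∀ i c x →
  ξ (suc (suc (suc i))) (c ∷ replicate (suc (suc i)) x) ≡ (if c ≡ᵇ x then + 0 else sign c)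
ξ-∷-replicate i false false = ξ-replicate (suc (suc (suc i))) false
ξ-∷-replicate i true  true  = ξ-replicate (suc (suc (suc i))) true
ξ-∷-replicate i true  false = ξ-flip-∷-replicate (suc i) false
ξ-∷-replicate i false true  = ξ-flip-∷-replicate (suc i) true

ξ-replicate-∷ʳ : ∀ i x d →
  ξ (suc (suc (suc i))) (replicate (suc (suc i)) x ∷ʳ d) ≡ (if d ≡ᵇ x then + 0 else sign x)
ξ-replicate-∷ʳ i false false = trans (cong (ξ (suc (suc (suc i)))) (sym (replicate-∷ʳ (suc (suc i)) false)))
                                     (ξ-replicate (suc (suc (suc i))) false)
ξ-replicate-∷ʳ i true  true  = trans (cong (ξ (suc (suc (suc i)))) (sym (replicate-∷ʳ (suc (suc i)) true)))
                                     (ξ-replicate (suc (suc (suc i))) true)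
ξ-replicate-∷ʳ i false true  = ξ-replicate-∷ʳ-flip (suc i) false
ξ-replicate-∷ʳ i true  false = ξ-replicate-∷ʳ-flip (suc i) true

ξ-∷-alternating : ∀ i c x → ξ (suc (suc (suc i))) (c ∷ alternating x (suc (suc i)))
  ≡ (if c ≡ᵇ x then sign x else if odd (suc (suc i)) then sign c else + 0)
ξ-∷-alternating i false false = ξ-repeat-∷-alternating i false
ξ-∷-alternating i true  true  = ξ-repeat-∷-alternating i true
ξ-∷-alternating i true  false = ξ-alternating (suc (suc (suc i))) true
ξ-∷-alternating i false true  = ξ-alternating (suc (suc (suc i))) false

ξ-alternating-∷ʳ : ∀ i x d → ξ (suc (suc (suc i))) (alternating x (suc (suc i)) ∷ʳ d)
  ≡ (if d ≡ᵇ (x xor odd (suc (suc i)))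
     then (if odd (suc (suc i)) then sign x else + 0)
     else sign (x xor odd (suc (suc i))))
ξ-alternating-∷ʳ i x d = by-letter d (x xor odd (suc (suc i))) refl
  where
  o : Bool
  o = odd (suc (suc i))
  continued : ∀ {e} → x xor o ≡ e →
    ξ (suc (suc (suc i))) (alternating x (suc (suc i)) ∷ʳ e) ≡ (if o then sign x else + 0)
  continued refl = trans (cong (ξ (suc (suc (suc i)))) (sym (alternating-∷ʳ x (suc (suc i)))))
                         (ξ-alternating (suc (suc (suc i))) x)
  doubled : ∀ {e} → x xor o ≡ e → ξ (suc (suc (suc i))) (alternating x (suc (suc i)) ∷ʳ not e) ≡ sign e
  doubled refl = ξ-alternating-doubled i x
  by-letter : ∀ d e → x xor o ≡ e → ξ (suc (suc (suc i))) (alternating x (suc (suc i)) ∷ʳ d)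
    ≡ (if d ≡ᵇ e then (if o then sign x else + 0) else sign e)
  by-letter false false = continued
  by-letter true  true  = continued
  by-letter true  false = doubled
  by-letter false true  = doubled

ξ-agree? : ∀ a b c d p o X Y → Dec (unfoldPeelξ a b c d p o X Y ≡ peelUnfoldξ a b c d p o X Y)
ξ-agree? a b c d p o X Y = unfoldPeelξ a b c d p o X Y ℤ.≟ peelUnfoldξ a b c d p o X Y

-- When the middle word is constant or alternating, both evaluations depend on six bits only.
ξ-agree-constant-at ξ-agree-alternating-at : Vec Bool 6 → Bool
ξ-agree-constant-at (a ∷ b ∷ c ∷ d ∷ x ∷ o ∷ []) = ⌊ ξ-agree? a b c d (constantProfile x) o
  (if c ≡ᵇ x then + 0 else sign c) (if d ≡ᵇ x then + 0 else sign x) ⌋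
ξ-agree-alternating-at (a ∷ b ∷ c ∷ d ∷ x ∷ o ∷ []) = ⌊ ξ-agree? a b c d (alternatingProfile x) o
  (if c ≡ᵇ x then sign x else if o then sign c else + 0)
  (if d ≡ᵇ (x xor o) then (if o then sign x else + 0) else sign (x xor o)) ⌋

ξ-agreement-cong : ∀ a b c d o {p p′ X X′ Y Y′} → p ≡ p′ → X ≡ X′ → Y ≡ Y′ →
  unfoldPeelξ a b c d p′ o X′ Y′ ≡ peelUnfoldξ a b c d p′ o X′ Y′ →
  unfoldPeelξ a b c d p o X Y ≡ peelUnfoldξ a b c d p o X Y
ξ-agreement-cong a b c d o refl refl refl agreement = agreement

ξ-agree : ∀ i a b c d (u : Word (suc (suc i))) → Shape u →
  unfoldPeelξ a b c d (profileOf u) (odd (suc (suc i))) (ξ (suc (suc (suc i))) (c ∷ u)) (ξ (suc (suc (suc i))) (u ∷ʳ d))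
  ≡ peelUnfoldξ a b c d (profileOf u) (odd (suc (suc i))) (ξ (suc (suc (suc i))) (c ∷ u)) (ξ (suc (suc (suc i))) (u ∷ʳ d))
ξ-agree i a b c d u (mixed mixed≡) = ξ-agreement-cong a b c d _ mixed≡ refl refl refl
ξ-agree i a b c d _ (constant x refl) = ξ-agreement-cong a b c d _
  (profileOf-replicate i x) (ξ-∷-replicate i c x) (ξ-replicate-∷ʳ i x d)
  (toWitness (allAssignments-sound 6 ξ-agree-constant-at _ (a ∷ b ∷ c ∷ d ∷ x ∷ odd (suc (suc i)) ∷ [])))
ξ-agree i a b c d _ (alternates x refl) = ξ-agreement-cong a b c d _
  (profileOf-alternating i x) (ξ-∷-alternating i c x) (ξ-alternating-∷ʳ i x d)
  (toWitness (allAssignments-sound 6 ξ-agree-alternating-at _ (a ∷ b ∷ c ∷ d ∷ x ∷ odd (suc (suc i)) ∷ [])))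

ξ-peel-step : ∀ i → ξ-Peels (suc (suc (suc i))) → ξ-Peels (suc (suc (suc (suc i))))
ξ-peel-step i peel a b w with frame w
... | framed c u d = trans (ξ-unfoldPeel peel a b c d u)
                           (trans (ξ-agree i a b c d u (shape u)) (ξ-peelUnfold a b c d u))

ξ-peel : ∀ n → ξ-Peels n
ξ-peel zero                      = ξ-peel-by-computation 0 _
ξ-peel (suc zero)                = ξ-peel-by-computation 1 _
ξ-peel (suc (suc zero))          = ξ-peel-by-computation 2 _
ξ-peel (suc (suc (suc zero)))    = ξ-peel-by-computation 3 _
ξ-peel (suc (suc (suc (suc i)))) = ξ-peel-step i (ξ-peel (suc (suc (suc i))))

oddConstantFrame evenConstantFlip : Bool → Profile → Bool → Bool → Bool
oddConstantFrame a p o b = ((const₀ p ∧ not (a ∨ b)) ∨ (const₁ p ∧ (a ∧ b))) ∧ o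
evenConstantFlip a p o b = (isConstant p ∧ (a xor b)) ∧ not o

φ-layer : Bool → Profile → Bool → Bool → ℤ → ℤ
φ-layer a p o b X =
  if oddConstantFrame a p o b then sign (not a)
  else if evenConstantFlip a p o b then sign a
  else - X

φ-Peels : ℕ → Set
φ-Peels n = ∀ a b (w : Word n) → φ (suc (suc n)) (a ∷ (w ∷ʳ b)) ≡ φ-layer a (profileOf w) (odd n) b (φ n w)

φ-peels? : ∀ n a b (w : Word n) → Dec (φ (suc (suc n)) (a ∷ (w ∷ʳ b)) ≡ φ-layer a (profileOf w) (odd n) b (φ n w))
φ-peels? n a b w = φ (suc (suc n)) (a ∷ (w ∷ʳ b)) ℤ.≟ φ-layer a (profileOf w) (odd n) b (φ n w)

φ-peels-at : ∀ n → Vec Bool (suc (suc n)) → Bool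
φ-peels-at n (a ∷ b ∷ w) = ⌊ φ-peels? n a b w ⌋

φ-peel-by-computation : ∀ n → B.T (allAssignments (suc (suc n)) (φ-peels-at n)) → φ-Peels n
φ-peel-by-computation n t a b w =
  toWitness {a? = φ-peels? n a b w} (allAssignments-sound (suc (suc n)) (φ-peels-at n) t (a ∷ b ∷ w))

unfoldPeelφ peelUnfoldφ : Bool → Bool → Bool → Bool → Profile → Bool → ℤ → ℤ → ℤ
unfoldPeelφ a b c d p o X Y =
  φ-step (consP a (consP c (snocP (snocP p o d) (not o) b))) (not (not (not (not o))))
         (φ-layer c (snocP p o d) (not o) b Y) (φ-layer a (consP c p) (not o) d X)
peelUnfoldφ a b c d p o X Y =
  φ-layer a (consP c (snocP p o d)) (not (not o)) b (φ-step (consP c (snocP p o d)) (not (not o)) Y X)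

φ-unfoldPeel : ∀ {m} → φ-Peels (suc m) → ∀ a b c d (u : Word m) →
  φ (suc (suc (suc (suc m)))) (a ∷ ((c ∷ (u ∷ʳ d)) ∷ʳ b))
  ≡ unfoldPeelφ a b c d (profileOf u) (odd m) (φ (suc m) (c ∷ u)) (φ (suc m) (u ∷ʳ d))
φ-unfoldPeel {m} peel a b c d u = φ-unfold-to (a ∷ ((c ∷ (u ∷ʳ d)) ∷ʳ b))
  (profileOf-∷-to a (c ∷ ((u ∷ʳ d) ∷ʳ b))
    (profileOf-∷-to c ((u ∷ʳ d) ∷ʳ b) (profileOf-∷ʳ-to (u ∷ʳ d) b (profileOf-∷ʳ u d))))
  (trans (peel c b (u ∷ʳ d)) (cong (λ p → φ-layer c p (not (odd m)) b (φ (suc m) (u ∷ʳ d))) (profileOf-∷ʳ u d)))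
  (trans (cong (φ (suc (suc (suc m)))) (init-∷ʳ b (a ∷ c ∷ (u ∷ʳ d))))
         (trans (peel a d (c ∷ u)) (cong (λ p → φ-layer a p (not (odd m)) d (φ (suc m) (c ∷ u))) (profileOf-∷ c u))))

φ-peelUnfold : ∀ {m} a b c d (u : Word m) →
  peelUnfoldφ a b c d (profileOf u) (odd m) (φ (suc m) (c ∷ u)) (φ (suc m) (u ∷ʳ d))
  ≡ φ-layer a (profileOf (c ∷ (u ∷ʳ d))) (odd (suc (suc m))) b (φ (suc (suc m)) (c ∷ (u ∷ʳ d)))
φ-peelUnfold {m} a b c d u = sym (cong₂ (λ p X → φ-layer a p (odd (suc (suc m))) b X) profile≡
  (φ-unfold-to (c ∷ (u ∷ʳ d)) profile≡ refl (cong (φ (suc m)) (init-∷ʳ d (c ∷ u)))))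
  where
  profile≡ : profileOf (c ∷ (u ∷ʳ d)) ≡ consP c (snocP (profileOf u) (odd m) d)
  profile≡ = profileOf-∷-to c (u ∷ʳ d) (profileOf-∷ʳ u d)

φ-∷-replicate : ∀ i c x → φ (suc (suc (suc i))) (c ∷ replicate (suc (suc i)) x)
  ≡ (if c ≡ᵇ x then (if odd (suc (suc (suc i))) then sign (not x) else + 0)
     else (if odd (suc (suc i)) then sign c else sign x))
φ-∷-replicate i false false = φ-replicate (suc (suc (suc i))) false
φ-∷-replicate i true  true  = φ-replicate (suc (suc (suc i))) true
φ-∷-replicate i true  false = φ-flip-∷-replicate (suc i) false
φ-∷-replicate i false true  = φ-flip-∷-replicate (suc i) true

φ-replicate-∷ʳ : ∀ i x d → φ (suc (suc (suc i))) (replicate (suc (suc i)) x ∷ʳ d)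
  ≡ (if d ≡ᵇ x then (if odd (suc (suc (suc i))) then sign (not x) else + 0) else sign x)
φ-replicate-∷ʳ i false false = trans (cong (φ (suc (suc (suc i)))) (sym (replicate-∷ʳ (suc (suc i)) false)))
                                     (φ-replicate (suc (suc (suc i))) false)
φ-replicate-∷ʳ i true  true  = trans (cong (φ (suc (suc (suc i)))) (sym (replicate-∷ʳ (suc (suc i)) true)))
                                     (φ-replicate (suc (suc (suc i))) true)
φ-replicate-∷ʳ i false true  = φ-replicate-∷ʳ-flip (suc i) false
φ-replicate-∷ʳ i true  false = φ-replicate-∷ʳ-flip (suc i) true

φ-agree? : ∀ a b c d p o X Y → Dec (unfoldPeelφ a b c d p o X Y ≡ peelUnfoldφ a b c d p o X Y)
φ-agree? a b c d p o X Y = unfoldPeelφ a b c d p o X Y ℤ.≟ peelUnfoldφ a b c d p o X Y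

φ-agree-constant-at : Vec Bool 6 → Bool
φ-agree-constant-at (a ∷ b ∷ c ∷ d ∷ x ∷ o ∷ []) = ⌊ φ-agree? a b c d (constantProfile x) o
  (if c ≡ᵇ x then (if not o then sign (not x) else + 0) else (if o then sign c else sign x))
  (if d ≡ᵇ x then (if not o then sign (not x) else + 0) else sign x) ⌋

sgn-neg : ∀ x → sgn (- x) ≡ - sgn x
sgn-neg (+ zero)  = refl
sgn-neg (+ suc _) = refl
sgn-neg -[1+ _ ]  = refl

-- Off constant words φ only changes sign when both ends are peeled.
φ-agree-nonconstant : ∀ a b c d o α β X Y →
  unfoldPeelφ a b c d (profile false false α β) o X Y ≡ peelUnfoldφ a b c d (profile false false α β) o X Y
φ-agree-nonconstant a b c d o α β X Y = trans (cong sgn (sym (neg-distrib-+ Y (- X)))) (sgn-neg (Y - X))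

φ-agreement-cong : ∀ a b c d o {p p′ X X′ Y Y′} → p ≡ p′ → X ≡ X′ → Y ≡ Y′ →
  unfoldPeelφ a b c d p′ o X′ Y′ ≡ peelUnfoldφ a b c d p′ o X′ Y′ →
  unfoldPeelφ a b c d p o X Y ≡ peelUnfoldφ a b c d p o X Y
φ-agreement-cong a b c d o refl refl refl agreement = agreement

φ-agree : ∀ i a b c d (u : Word (suc (suc i))) → Shape u →
  unfoldPeelφ a b c d (profileOf u) (odd (suc (suc i))) (φ (suc (suc (suc i))) (c ∷ u)) (φ (suc (suc (suc i))) (u ∷ʳ d))
  ≡ peelUnfoldφ a b c d (profileOf u) (odd (suc (suc i))) (φ (suc (suc (suc i))) (c ∷ u)) (φ (suc (suc (suc i))) (u ∷ʳ d))
φ-agree i a b c d u (mixed mixed≡) = φ-agreement-cong a b c d _ mixed≡ refl refl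
  (φ-agree-nonconstant a b c d (odd (suc (suc i))) false false (φ (suc (suc (suc i))) (c ∷ u)) (φ (suc (suc (suc i))) (u ∷ʳ d)))
φ-agree i a b c d _ (alternates x refl) = φ-agreement-cong a b c d _ (profileOf-alternating i x) refl refl
  (φ-agree-nonconstant a b c d (odd (suc (suc i))) (x ≡ᵇ false) (x ≡ᵇ true) (φ (suc (suc (suc i))) (c ∷ alternating x (suc (suc i))))
                                     (φ (suc (suc (suc i))) (alternating x (suc (suc i)) ∷ʳ d)))
φ-agree i a b c d _ (constant x refl) = φ-agreement-cong a b c d _
  (profileOf-replicate i x) (φ-∷-replicate i c x) (φ-replicate-∷ʳ i x d)
  (toWitness (allAssignments-sound 6 φ-agree-constant-at _ (a ∷ b ∷ c ∷ d ∷ x ∷ odd (suc (suc i)) ∷ [])))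

φ-peel-step : ∀ i → φ-Peels (suc (suc (suc i))) → φ-Peels (suc (suc (suc (suc i))))
φ-peel-step i peel a b w with frame w
... | framed c u d = trans (φ-unfoldPeel peel a b c d u)
                           (trans (φ-agree i a b c d u (shape u)) (φ-peelUnfold a b c d u))

φ-peel : ∀ n → φ-Peels n
φ-peel zero                      = φ-peel-by-computation 0 _
φ-peel (suc zero)                = φ-peel-by-computation 1 _
φ-peel (suc (suc zero))          = φ-peel-by-computation 2 _
φ-peel (suc (suc (suc zero)))    = φ-peel-by-computation 3 _
φ-peel (suc (suc (suc (suc i)))) = φ-peel-step i (φ-peel (suc (suc (suc i))))

-- Zeros of ψ

isZero : ℤ → Bool
isZero x = does (x ℤ.≟ + 0)

isZero-if-sign : ∀ c a X → isZero (if c then sign a else X) ≡ not c ∧ isZero X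
isZero-if-sign false a     X = refl
isZero-if-sign true  false X = refl
isZero-if-sign true  true  X = refl

isZero-neg : ∀ x → isZero (- x) ≡ isZero x
isZero-neg (+ zero)  = refl
isZero-neg (+ suc _) = refl
isZero-neg -[1+ _ ]  = refl

isZero-* : ∀ x y → isZero (x * y) ≡ isZero x ∨ isZero y
isZero-* x y with x ℤ.≟ + 0 | y ℤ.≟ + 0
... | yes refl | _        = refl
... | no  _    | yes refl = dec-true (x * + 0 ℤ.≟ + 0) (*-zeroʳ x)
... | no  x≢0  | no  y≢0  = dec-false (x * y ℤ.≟ + 0) ([ x≢0 , y≢0 ] ∘ i*j≡0⇒i≡0∨j≡0 x)

isZero-^ : ∀ x k → isZero (x ^ suc k) ≡ isZero x
isZero-^ x zero    = trans (isZero-* x (+ 1)) (∨-identityʳ (isZero x))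
isZero-^ x (suc k) = trans (isZero-* x (x ^ suc k)) (trans (cong (isZero x ∨_) (isZero-^ x k)) (∨-idem (isZero x)))

isZero-ψ : ∀ k (w : Word (suc k)) → isZero (ψ (suc k) w) ≡ isZero (ξ (suc k) w) ∨ isZero (φ (suc k) w)
isZero-ψ k w = trans (isZero-* (ξ (suc k) w ^ suc k) (φ (suc k) w)) (cong (_∨ isZero (φ (suc k) w)) (isZero-^ (ξ (suc k) w) k))

not-∧-cong : ∀ {c c′ z} → (z ≡ true → c ≡ c′) → not c ∧ z ≡ not c′ ∧ z
not-∧-cong {c} {c′} {false} _        = trans (∧-zeroʳ (not c)) (sym (∧-zeroʳ (not c′)))
not-∧-cong          {z = true}  c≡c′ = cong (λ c → not c ∧ true) (c≡c′ refl)

special-even : ∀ p → special p false ≡ isConstant p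
special-even p = trans (cong (isConstant p ∨_) (∧-zeroʳ (isAlternating p))) (∨-identityʳ (isConstant p))

-- ξ-flips differs from special p o ∧ (a xor b) only when a ∷ w alternates, and then ξ w ≠ 0.
ξ-flips-on-zero : ∀ k a b (w : Word (suc (suc k))) → Shape w → isZero (ξ (suc (suc k)) w) ≡ true →
  ξ-flips a (profileOf w) (odd (suc (suc k))) b ≡ special (profileOf w) (odd (suc (suc k))) ∧ (a xor b)
ξ-flips-on-zero k a b w (mixed mixed≡) _ =
  subst (λ p → ξ-flips a p o b ≡ special p o ∧ (a xor b)) (sym mixed≡) refl
  where
  o : Bool
  o = odd (suc (suc k))
ξ-flips-on-zero k a b _ (constant x refl) _ =
  subst (λ p → ξ-flips a p o b ≡ special p o ∧ (a xor b)) (sym (profileOf-replicate k x))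
        (cong (_∧ (a xor b)) (∨-identityʳ (special (constantProfile x) o)))
  where
  o : Bool
  o = odd (suc (suc k))
ξ-flips-on-zero k a b _ (alternates x refl) ξ≡0 =
  subst (λ p → ξ-flips a p (odd (suc (suc k))) b ≡ special p (odd (suc (suc k))) ∧ (a xor b))
        (sym (profileOf-alternating k x))
        (odd-length x (odd k) (trans (sym (cong isZero (ξ-alternating (suc (suc k)) x))) ξ≡0))
  where
  odd-length : ∀ x q → isZero (if not q then sign x else + 0) ≡ true →
    ξ-flips a (alternatingProfile x) (not (not q)) b ≡ special (alternatingProfile x) (not (not q)) ∧ (a xor b)
  odd-length false true _ = refl
  odd-length true  true _ = refl

ξ-zero-peel : ∀ k a b (w : Word (suc (suc k))) → isZero (ξ (suc (suc (suc (suc k)))) (a ∷ (w ∷ʳ b)))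
  ≡ not (special (profileOf w) (odd (suc (suc k))) ∧ (a xor b)) ∧ isZero (ξ (suc (suc k)) w)
ξ-zero-peel k a b w = begin
  isZero (ξ (suc (suc (suc (suc k)))) (a ∷ (w ∷ʳ b)))
    ≡⟨ cong isZero (ξ-peel (suc (suc k)) a b w) ⟩
  isZero (ξ-layer a (profileOf w) o b (ξ (suc (suc k)) w))
    ≡⟨ isZero-if-sign (ξ-flips a (profileOf w) o b) a (ξ (suc (suc k)) w) ⟩
  not (ξ-flips a (profileOf w) o b) ∧ isZero (ξ (suc (suc k)) w)
    ≡⟨ not-∧-cong (ξ-flips-on-zero k a b w (shape w)) ⟩
  not (special (profileOf w) o ∧ (a xor b)) ∧ isZero (ξ (suc (suc k)) w) ∎
  where
  open ≡-Reasoning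
  o : Bool
  o = odd (suc (suc k))

isZero-φ-layer : ∀ a p o b X → isZero (φ-layer a p o b X)
  ≡ not (oddConstantFrame a p o b) ∧ (not (evenConstantFlip a p o b) ∧ isZero X)
isZero-φ-layer a p o b X =
  trans (isZero-if-sign (oddConstantFrame a p o b) (not a) _)
        (cong (not (oddConstantFrame a p o b) ∧_)
              (trans (isZero-if-sign (evenConstantFlip a p o b) a (- X))
                     (cong (not (evenConstantFlip a p o b) ∧_) (isZero-neg X))))

φ-OddNonzero : ℕ → Set
φ-OddNonzero n = ∀ (w : Word n) → odd n ≡ true → isZero (φ n w) ≡ false

φ-odd-nonzero-step : ∀ k → φ-OddNonzero k → φ-OddNonzero (suc (suc k))
φ-odd-nonzero-step k nonzero w odd≡ with frame w
... | framed a u b = begin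
  isZero (φ (suc (suc k)) (a ∷ (u ∷ʳ b)))
    ≡⟨ cong isZero (φ-peel k a b u) ⟩
  isZero (φ-layer a (profileOf u) (odd k) b (φ k u))
    ≡⟨ isZero-φ-layer a (profileOf u) (odd k) b (φ k u) ⟩
  not C₁ ∧ (not C₂ ∧ isZero (φ k u))
    ≡⟨ cong (λ z → not C₁ ∧ (not C₂ ∧ z)) (nonzero u (trans (sym (not-involutive (odd k))) odd≡)) ⟩
  not C₁ ∧ (not C₂ ∧ false)
    ≡⟨ trans (cong (not C₁ ∧_) (∧-zeroʳ (not C₂))) (∧-zeroʳ (not C₁)) ⟩
  false ∎
  where
  open ≡-Reasoning
  C₁ C₂ : Bool
  C₁ = oddConstantFrame a (profileOf u) (odd k) b
  C₂ = evenConstantFlip a (profileOf u) (odd k) b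

φ-odd-nonzero : ∀ n → φ-OddNonzero n
φ-odd-nonzero zero          []          ()
φ-odd-nonzero (suc zero)    (false ∷ []) _ = refl
φ-odd-nonzero (suc zero)    (true ∷ [])  _ = refl
φ-odd-nonzero (suc (suc k)) = φ-odd-nonzero-step k (φ-odd-nonzero k)

φ-zero-peel : ∀ n a b (w : Word n) → isZero (φ (suc (suc n)) (a ∷ (w ∷ʳ b)))
  ≡ not (special (profileOf w) (odd n) ∧ (a xor b)) ∧ isZero (φ n w)
φ-zero-peel n a b w =
  trans (cong isZero (φ-peel n a b w))
        (trans (isZero-φ-layer a (profileOf w) (odd n) b (φ n w))
               (by-parity (odd n) (φ-odd-nonzero n w)))
  where
  p : Profile
  p = profileOf w
  by-parity : ∀ o → (o ≡ true → isZero (φ n w) ≡ false) →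
    not (oddConstantFrame a p o b) ∧ (not (evenConstantFlip a p o b) ∧ isZero (φ n w))
    ≡ not (special p o ∧ (a xor b)) ∧ isZero (φ n w)
  by-parity false _ =
    trans (cong₂ (λ c₁ c₂ → not c₁ ∧ (not c₂ ∧ isZero (φ n w)))
                 (∧-zeroʳ (((const₀ p ∧ not (a ∨ b)) ∨ (const₁ p ∧ (a ∧ b)))))
                 (∧-identityʳ (isConstant p ∧ (a xor b))))
          (cong (λ s → not (s ∧ (a xor b)) ∧ isZero (φ n w)) (sym (special-even p)))
  by-parity true nonzero rewrite nonzero refl =
    trans (cong (not (oddConstantFrame a p true b) ∧_) (∧-zeroʳ _))
          (trans (∧-zeroʳ _) (sym (∧-zeroʳ _)))

zero-peel : ∀ k a b (w : Word (suc (suc k))) → isZero (ψ (suc (suc (suc (suc k)))) (a ∷ (w ∷ʳ b)))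
  ≡ not (special (profileOf w) (odd (suc (suc k))) ∧ (a xor b)) ∧ isZero (ψ (suc (suc k)) w)
zero-peel k a b w = begin
  isZero (ψ (suc (suc (suc (suc k)))) (a ∷ (w ∷ʳ b)))
    ≡⟨ isZero-ψ (suc (suc (suc k))) (a ∷ (w ∷ʳ b)) ⟩
  isZero (ξ _ (a ∷ (w ∷ʳ b))) ∨ isZero (φ _ (a ∷ (w ∷ʳ b)))
    ≡⟨ cong₂ _∨_ (ξ-zero-peel k a b w) (φ-zero-peel (suc (suc k)) a b w) ⟩
  (keep ∧ isZero (ξ (suc (suc k)) w)) ∨ (keep ∧ isZero (φ (suc (suc k)) w))
    ≡⟨ sym (∧-distribˡ-∨ keep _ _) ⟩
  keep ∧ (isZero (ξ (suc (suc k)) w) ∨ isZero (φ (suc (suc k)) w))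
    ≡⟨ cong (keep ∧_) (sym (isZero-ψ (suc k) w)) ⟩
  keep ∧ isZero (ψ (suc (suc k)) w) ∎
  where
  open ≡-Reasoning
  keep : Bool
  keep = not (special (profileOf w) (odd (suc (suc k))) ∧ (a xor b))

-- Counting

count : ∀ n → (Word n → Bool) → ℕ
count zero    p = if p [] then 1 else 0
count (suc n) p = count n (λ w → p (false ∷ w)) ℕ.+ count n (λ w → p (true ∷ w))

length-filter-map : ∀ {A B : Set} {P : B → Set} (P? : U.Decidable P) (f : A → B) xs →
  length (filter P? (L.map f xs)) ≡ length (filter (P? ∘ f) xs)
length-filter-map P? f L.[]       = refl
length-filter-map P? f (x L.∷ xs) with does (P? (f x))
... | true  = cong suc (length-filter-map P? f xs)
... | false = length-filter-map P? f xs

length-filter-allWords : ∀ n {P : Word n → Set} (P? : U.Decidable P) →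
  length (filter P? (allWords n)) ≡ count n (λ w → does (P? w))
length-filter-allWords zero P? with does (P? [])
... | true  = refl
... | false = refl
length-filter-allWords (suc n) P? = begin
  length (filter P? (L.map (false ∷_) (allWords n) L.++ L.map (true ∷_) (allWords n)))
    ≡⟨ cong length (filter-++ P? (L.map (false ∷_) (allWords n)) (L.map (true ∷_) (allWords n))) ⟩
  length (filter P? (L.map (false ∷_) (allWords n)) L.++ filter P? (L.map (true ∷_) (allWords n)))
    ≡⟨ length-++ (filter P? (L.map (false ∷_) (allWords n))) ⟩
  length (filter P? (L.map (false ∷_) (allWords n))) ℕ.+ length (filter P? (L.map (true ∷_) (allWords n)))
    ≡⟨ cong₂ ℕ._+_ (half false) (half true) ⟩
  count (suc n) (λ w → does (P? w)) ∎
  where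
  open ≡-Reasoning
  half : ∀ x → length (filter P? (L.map (x ∷_) (allWords n))) ≡ count n (λ w → does (P? (x ∷ w)))
  half x = trans (length-filter-map P? (x ∷_) (allWords n)) (length-filter-allWords n (P? ∘ (x ∷_)))

K-as-count : ∀ n → K n ≡ count n (λ w → isZero (ψ n w))
K-as-count n = length-filter-allWords n (λ w → ψ n w ℤ.≟ + 0)

count-cong : ∀ n {p q : Word n → Bool} → (∀ w → p w ≡ q w) → count n p ≡ count n q
count-cong zero    p≡q = cong (λ c → if c then 1 else 0) (p≡q [])
count-cong (suc n) p≡q = cong₂ ℕ._+_ (count-cong n (p≡q ∘ (false ∷_))) (count-cong n (p≡q ∘ (true ∷_)))

count-false : ∀ n → count n (λ _ → false) ≡ 0
count-false zero    = refl
count-false (suc n) = cong₂ ℕ._+_ (count-false n) (count-false n)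

count-==-∨ : ∀ n (v : Word n) p → p v ≡ false → count n (λ w → (w == v) ∨ p w) ≡ suc (count n p)
count-==-∨ zero    []          p pv≡false = sym (cong (λ c → suc (if c then 1 else 0)) pv≡false)
count-==-∨ (suc n) (false ∷ v) p pv≡false =
  cong (ℕ._+ count n (λ w → p (true ∷ w))) (count-==-∨ n v (λ w → p (false ∷ w)) pv≡false)
count-==-∨ (suc n) (true ∷ v)  p pv≡false =
  trans (cong (count n (λ w → p (false ∷ w)) ℕ.+_) (count-==-∨ n v (λ w → p (true ∷ w)) pv≡false))
        (ℕ.+-suc (count n (λ w → p (false ∷ w))) (count n (λ w → p (true ∷ w))))

count-== : ∀ n (v : Word n) → count n (_== v) ≡ 1
count-== n v = trans (count-cong n (λ w → sym (∨-identityʳ (w == v))))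
                     (trans (count-==-∨ n v (λ _ → false) refl) (cong suc (count-false n)))

count-∷ʳ : ∀ n p → count (suc n) p ≡ count n (λ w → p (w ∷ʳ false)) ℕ.+ count n (λ w → p (w ∷ʳ true))
count-∷ʳ zero    p = refl
count-∷ʳ (suc n) p =
  trans (cong₂ ℕ._+_ (count-∷ʳ n (λ w → p (false ∷ w))) (count-∷ʳ n (λ w → p (true ∷ w))))
        (+-interchange (count n (λ w → p (false ∷ (w ∷ʳ false)))) (count n (λ w → p (false ∷ (w ∷ʳ true))))
                       (count n (λ w → p (true ∷ (w ∷ʳ false)))) (count n (λ w → p (true ∷ (w ∷ʳ true)))))

count-partition : ∀ n (p q : Word n → Bool) →
  count n (λ w → not (q w) ∧ p w) ℕ.+ count n (λ w → q w ∧ p w) ≡ count n p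
count-partition zero p q with q [] | p []
... | false | false = refl
... | false | true  = refl
... | true  | false = refl
... | true  | true  = refl
count-partition (suc n) p q =
  trans (+-interchange (count n (λ w → not (q (false ∷ w)) ∧ p (false ∷ w)))
                       (count n (λ w → not (q (true ∷ w)) ∧ p (true ∷ w)))
                       (count n (λ w → q (false ∷ w) ∧ p (false ∷ w)))
                       (count n (λ w → q (true ∷ w) ∧ p (true ∷ w))))
        (cong₂ ℕ._+_ (count-partition n (λ w → p (false ∷ w)) (λ w → q (false ∷ w)))
                     (count-partition n (λ w → p (true ∷ w)) (λ w → q (true ∷ w))))

count-special : ∀ k o → count (suc (suc k)) (λ w → special (profileOf w) o) ≡ (if o then 4 else 2)
count-special k false = begin
  count (suc (suc k)) (λ w → special (profileOf w) false)
    ≡⟨ count-cong (suc (suc k)) (λ w → special-even (profileOf w)) ⟩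
  count (suc (suc k)) (λ w → (w == zeros) ∨ (w == ones))
    ≡⟨ count-==-∨ (suc (suc k)) zeros (_== ones) refl ⟩
  suc (count (suc (suc k)) (_== ones))
    ≡⟨ cong suc (count-== (suc (suc k)) ones) ⟩
  2 ∎
  where
  open ≡-Reasoning
  zeros ones : Word (suc (suc k))
  zeros = replicate (suc (suc k)) false
  ones  = replicate (suc (suc k)) true
count-special k true = begin
  count (suc (suc k)) (λ w → special (profileOf w) true)
    ≡⟨ count-cong (suc (suc k)) (λ w → special-odd (profileOf w)) ⟩
  count (suc (suc k)) (λ w → (w == zeros) ∨ ((w == ones) ∨ ((w == alternating₀) ∨ (w == alternating₁))))
    ≡⟨ count-==-∨ (suc (suc k)) zeros (λ w → (w == ones) ∨ ((w == alternating₀) ∨ (w == alternating₁))) refl ⟩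
  suc (count (suc (suc k)) (λ w → (w == ones) ∨ ((w == alternating₀) ∨ (w == alternating₁))))
    ≡⟨ cong suc (count-==-∨ (suc (suc k)) ones (λ w → (w == alternating₀) ∨ (w == alternating₁)) refl) ⟩
  suc (suc (count (suc (suc k)) (λ w → (w == alternating₀) ∨ (w == alternating₁))))
    ≡⟨ cong (suc ∘ suc) (count-==-∨ (suc (suc k)) alternating₀ (_== alternating₁) refl) ⟩
  suc (suc (suc (count (suc (suc k)) (_== alternating₁))))
    ≡⟨ cong (suc ∘ suc ∘ suc) (count-== (suc (suc k)) alternating₁) ⟩
  4 ∎
  where
  open ≡-Reasoning
  zeros ones : Word (suc (suc k))
  zeros = replicate (suc (suc k)) false
  ones  = replicate (suc (suc k)) true
  alternating₀ alternating₁ : Word (suc (suc k))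
  alternating₀ = alternating false (suc (suc k))
  alternating₁ = alternating true (suc (suc k))
  special-odd : ∀ p → special p true ≡ const₀ p ∨ (const₁ p ∨ (alt₀ p ∨ alt₁ p))
  special-odd p = trans (cong (isConstant p ∨_) (∧-identityʳ (isAlternating p)))
                        (∨-assoc (const₀ p) (const₁ p) (isAlternating p))

special-ξ-zero : ∀ k (w : Word (suc (suc k))) → Shape w →
  special (profileOf w) (odd (suc (suc k))) ≡ true → isZero (ξ (suc (suc k)) w) ≡ true
special-ξ-zero k w (mixed mixed≡) special≡true =
  contradiction (trans (sym (cong (λ p → special p (odd (suc (suc k)))) mixed≡)) special≡true) λ ()
special-ξ-zero k _ (constant x refl) _ = cong isZero (ξ-replicate (suc (suc k)) x)
special-ξ-zero k _ (alternates x refl) special≡true = trans (cong isZero (ξ-alternating (suc (suc k)) x))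
  (odd-length x (odd k) (trans (sym (cong (λ p → special p (odd (suc (suc k)))) (profileOf-alternating k x)))
                               special≡true))
  where
  odd-length : ∀ x q → special (alternatingProfile x) (not (not q)) ≡ true →
    isZero (if not q then sign x else + 0) ≡ true
  odd-length x     true  _  = refl
  odd-length false false ()
  odd-length true  false ()

special⇒zero : ∀ k (w : Word (suc (suc k))) →
  special (profileOf w) (odd (suc (suc k))) ≡ true → isZero (ψ (suc (suc k)) w) ≡ true
special⇒zero k w special≡true =
  trans (isZero-ψ (suc k) w) (cong (_∨ isZero (φ (suc (suc k)) w)) (special-ξ-zero k w (shape w) special≡true))

nonColourable : ∀ n → Word n → Bool
nonColourable n w = isZero (ψ n w)

isSpecial : ∀ {n} → Word n → Bool
isSpecial {n} w = special (profileOf w) (odd n)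

∧-absorbs : ∀ {s z} → (s ≡ true → z ≡ true) → s ∧ z ≡ s
∧-absorbs {false} _   = refl
∧-absorbs {true}  s⇒z = s⇒z refl

count-frame : ∀ n p → count (suc (suc n)) p
  ≡ (count n (λ w → p (false ∷ (w ∷ʳ false))) ℕ.+ count n (λ w → p (false ∷ (w ∷ʳ true))))
    ℕ.+ (count n (λ w → p (true ∷ (w ∷ʳ false))) ℕ.+ count n (λ w → p (true ∷ (w ∷ʳ true))))
count-frame n p = cong₂ ℕ._+_ (count-∷ʳ n (λ w → p (false ∷ w))) (count-∷ʳ n (λ w → p (true ∷ w)))

count-recurrence : ∀ k → count (suc (suc (suc (suc k)))) (nonColourable (suc (suc (suc (suc k)))))
  ℕ.+ 2 ℕ.* count (suc (suc k)) isSpecial ≡ 4 ℕ.* count (suc (suc k)) (nonColourable (suc (suc k)))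
count-recurrence k = begin
  count (suc (suc (suc (suc k)))) (nonColourable (suc (suc (suc (suc k))))) ℕ.+ 2 ℕ.* Sc
    ≡⟨ cong (ℕ._+ 2 ℕ.* Sc) (count-frame (suc (suc k)) (nonColourable (suc (suc (suc (suc k)))))) ⟩
  ((ends false false ℕ.+ ends false true) ℕ.+ (ends true false ℕ.+ ends true true)) ℕ.+ 2 ℕ.* Sc
    ≡⟨ cong (ℕ._+ 2 ℕ.* Sc) (cong₂ ℕ._+_ (cong₂ ℕ._+_ (same-ends false false refl) (flipped-ends false true refl))
                                        (cong₂ ℕ._+_ (flipped-ends true false refl) (same-ends true true refl))) ⟩
  ((Zc ℕ.+ A) ℕ.+ (A ℕ.+ Zc)) ℕ.+ 2 ℕ.* Sc
    ≡⟨ cong (λ z → ((z ℕ.+ A) ℕ.+ (A ℕ.+ z)) ℕ.+ 2 ℕ.* Sc) (sym A+Sc≡Zc) ⟩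
  (((A ℕ.+ Sc) ℕ.+ A) ℕ.+ (A ℕ.+ (A ℕ.+ Sc))) ℕ.+ 2 ℕ.* Sc
    ≡⟨ arithmetic A Sc ⟩
  4 ℕ.* (A ℕ.+ Sc)
    ≡⟨ cong (4 ℕ.*_) A+Sc≡Zc ⟩
  4 ℕ.* Zc ∎
  where
  open ≡-Reasoning
  Z : Word (suc (suc k)) → Bool
  Z = nonColourable (suc (suc k))
  Zc Sc A : ℕ
  Zc = count (suc (suc k)) Z
  Sc = count (suc (suc k)) isSpecial
  A  = count (suc (suc k)) (λ w → not (isSpecial w) ∧ Z w)
  ends : Bool → Bool → ℕ
  ends a b = count (suc (suc k)) (λ w → nonColourable (suc (suc (suc (suc k)))) (a ∷ (w ∷ʳ b)))
  same-ends : ∀ a b → a xor b ≡ false → ends a b ≡ Zc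
  same-ends a b same = count-cong (suc (suc k)) λ w → trans (zero-peel k a b w)
    (cong (λ c → not c ∧ Z w) (trans (cong (isSpecial w ∧_) same) (∧-zeroʳ (isSpecial w))))
  flipped-ends : ∀ a b → a xor b ≡ true → ends a b ≡ A
  flipped-ends a b flipped = count-cong (suc (suc k)) λ w → trans (zero-peel k a b w)
    (cong (λ c → not c ∧ Z w) (trans (cong (isSpecial w ∧_) flipped) (∧-identityʳ (isSpecial w))))
  A+Sc≡Zc : A ℕ.+ Sc ≡ Zc
  A+Sc≡Zc = trans (cong (A ℕ.+_) (count-cong (suc (suc k)) λ w → sym (∧-absorbs (special⇒zero k w))))
                  (count-partition (suc (suc k)) Z isSpecial)
  arithmetic : ∀ A S → (((A ℕ.+ S) ℕ.+ A) ℕ.+ (A ℕ.+ (A ℕ.+ S))) ℕ.+ 2 ℕ.* S ≡ 4 ℕ.* (A ℕ.+ S)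
  arithmetic = ℕ-solve-∀

neg-one-^ : ∀ n → -[1+ 0 ] ^ n ≡ (if odd n then -[1+ 0 ] else + 1)
neg-one-^ zero    = refl
neg-one-^ (suc n) = trans (cong (-[1+ 0 ] *_) (neg-one-^ n)) (negate (odd n))
  where
  negate : ∀ o → -[1+ 0 ] * (if o then -[1+ 0 ] else + 1) ≡ (if not o then -[1+ 0 ] else + 1)
  negate false = refl
  negate true  = refl

twice-special-count : ∀ o → + (2 ℕ.* (if o then 4 else 2)) ≡ + 6 - + 2 * (if o then -[1+ 0 ] else + 1)
twice-special-count false = refl
twice-special-count true  = refl

recurrence-ℤ : ∀ K₄ K₂ s e → K₄ ℕ.+ s ≡ 4 ℕ.* K₂ → + s ≡ + 6 - + 2 * e →
  + K₄ ≡ (+ 4 * + K₂ - + 6) + + 2 * e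
recurrence-ℤ K₄ K₂ s e K₄+s≡4K₂ s≡6-2e = begin
  + K₄
    ≡⟨ shift (+ K₄) e ⟩
  ((+ K₄ + (+ 6 - + 2 * e)) - + 6) + + 2 * e
    ≡⟨ cong (λ t → ((+ K₄ + t) - + 6) + + 2 * e) (sym s≡6-2e) ⟩
  ((+ K₄ + + s) - + 6) + + 2 * e
    ≡⟨ cong (λ t → (t - + 6) + + 2 * e) (trans (sym (pos-+ K₄ s)) (trans (cong +_ K₄+s≡4K₂) (pos-* 4 K₂))) ⟩
  (+ 4 * + K₂ - + 6) + + 2 * e ∎
  where
  open ≡-Reasoning
  shift : ∀ x e → x ≡ ((x + (+ 6 - + 2 * e)) - + 6) + + 2 * e
  shift = ℤ-solve-∀

corollary6p3 : (n : ℕ) → 4 ≤ n →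
    + K n ≡ (+ 4 * + K (n ∸ 2) - + 6) + + 2 * (-[1+ 0 ] ^ n)
corollary6p3 (suc (suc (suc (suc k)))) (s≤s (s≤s (s≤s (s≤s _)))) = begin
  + K (suc (suc (suc (suc k))))
    ≡⟨ cong +_ (K-as-count (suc (suc (suc (suc k))))) ⟩
  + count (suc (suc (suc (suc k)))) (nonColourable (suc (suc (suc (suc k)))))
    ≡⟨ recurrence-ℤ _ (count (suc (suc k)) (nonColourable (suc (suc k)))) _ (if o then -[1+ 0 ] else + 1)
         (count-recurrence k)
         (trans (cong (λ c → + (2 ℕ.* c)) (count-special k o)) (twice-special-count o)) ⟩
  (+ 4 * + count (suc (suc k)) (nonColourable (suc (suc k))) - + 6) + + 2 * (if o then -[1+ 0 ] else + 1)
    ≡⟨ cong₂ (λ K₂ e → (+ 4 * + K₂ - + 6) + + 2 * e) (sym (K-as-count (suc (suc k))))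
             (sym (trans (neg-one-^ (suc (suc (suc (suc k))))) (cong (λ o → if o then -[1+ 0 ] else + 1) (not-involutive o)))) ⟩
  (+ 4 * + K (suc (suc k)) - + 6) + + 2 * (-[1+ 0 ] ^ suc (suc (suc (suc k)))) ∎
  where
  open ≡-Reasoning
  o : Bool
  o = odd (suc (suc k))
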